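{- Let $G$ be a finite simple graph with no isolated vertex and maximum degree $\Delta(G)$. Then for every $DC(G)$-partition $\Pi$ of $G$ and every $X\in\Pi$, the number of sets $Y\in\Pi$ such that $X$ and $Y$ form a double coalition is at most $\Delta(G)$.
   Context: Let $G=(V,E)$ be a finite simple undirected graph, $N[v]=\{v\}\cup N(v)$. A set $D\subseteq V$ is a double dominating set if $|N[v]\cap D|\ge 2$ for every $v\in V$. Two disjoint sets $V_1,V_2\subseteq V$ form a double coalition if neither is a double dominating set but $V_1\cup V_2$ is. A double coalition partition ($dc$-partition) of $G$ is a partition $\Pi$ of $V$ such that every set of $\Pi$ is not a double dominating set and forms a double coalition with some other set of $\Pi$. The double coalition number $DC(G)$ is the maximum cardinality of a $dc$-partition of $G$, and a $DC(G)$-partition is a $dc$-partition with exactly $DC(G)$ sets. -}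

module Defs where

open import Data.Nat using (ℕ; zero; suc; _+_; _≤_; _⊔_)
open import Data.Fin using (Fin; zero; suc; _≟_)
open import Data.Bool using (Bool; true; false; _∧_; _∨_; if_then_else_)
open import Data.Product using (Σ; ∃; _×_; _,_)
open import Relation.Nullary using (¬_; does)
open import Relation.Binary.PropositionalEquality using (_≡_; _≢_)
open import Function.Definitions using (Injective; Surjective)

record Graph : Set where
  field
    n      : ℕ
    adj    : Fin n → Fin n → Bool
    sym    : ∀ u v → adj u v ≡ adj v u
    irrefl : ∀ v → adj v v ≡ false
open Graph public

VSet : ℕ → Set
VSet n = Fin n → Bool

card : ∀ {n} → (Fin n → Bool) → ℕ
card {zero}  P = 0
card {suc n} P = (if P zero then 1 else 0) + card (λ i → P (suc i))

maxOver : ∀ {n} → (Fin n → ℕ) → ℕ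
maxOver {zero}  f = 0
maxOver {suc n} f = f zero ⊔ maxOver (λ i → f (suc i))

degree : (G : Graph) → Fin (n G) → ℕ
degree G v = card (adj G v)

maxDegree : Graph → ℕ
maxDegree G = maxOver (degree G)

NoIsolatedVertex : Graph → Set
NoIsolatedVertex G = ∀ v → ∃ λ u → adj G v u ≡ true

closedNbr : (G : Graph) → Fin (n G) → Fin (n G) → Bool
closedNbr G v u = does (u ≟ v) ∨ adj G v u

DoubleDominating : (G : Graph) → VSet (n G) → Set
DoubleDominating G D = ∀ v → 2 ≤ card (λ u → closedNbr G v u ∧ D u)

_∪ˢ_ : ∀ {n} → VSet n → VSet n → VSet n
(A ∪ˢ B) u = A u ∨ B u

Disjoint : ∀ {n} → VSet n → VSet n → Set
Disjoint A B = ∀ u → A u ∧ B u ≡ false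

DoubleCoalition : (G : Graph) → VSet (n G) → VSet (n G) → Set
DoubleCoalition G V₁ V₂ =
  Disjoint V₁ V₂ × ¬ DoubleDominating G V₁ × ¬ DoubleDominating G V₂
  × DoubleDominating G (V₁ ∪ˢ V₂)

-- A partition of V(G) into k (nonempty) sets is a surjection c : V → Fin k;
-- the i-th set is c⁻¹(i).
part : (G : Graph) {k : ℕ} → (Fin (n G) → Fin k) → Fin k → VSet (n G)
part G c i v = does (c v ≟ i)

IsPartition : (G : Graph) (k : ℕ) → (Fin (n G) → Fin k) → Set
IsPartition G k c = Surjective _≡_ _≡_ c

IsDCPartition : (G : Graph) (k : ℕ) → (Fin (n G) → Fin k) → Set
IsDCPartition G k c =
  IsPartition G k c
  × (∀ i → ¬ DoubleDominating G (part G c i))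
  × (∀ i → ∃ λ j → j ≢ i × DoubleCoalition G (part G c i) (part G c j))

IsDCMaxPartition : (G : Graph) (k : ℕ) → (Fin (n G) → Fin k) → Set
IsDCMaxPartition G k c =
  IsDCPartition G k c
  × (∀ k′ (c′ : Fin (n G) → Fin k′) → IsDCPartition G k′ c′ → k′ ≤ k)

-- X is not double dominating, so some vertex v has at most one vertex of X in its closed
-- neighbourhood N[v], while N[v] meets X ∪ Y twice for every partner Y of X. Hence every
-- partner meets N[v]. The partners are classes of the partition, pairwise disjoint and
-- disjoint from X, so one vertex of N[v] from each partner, together with one more vertex
-- (from X if X meets N[v]; otherwise a second vertex of some partner, which then meets N[v]
-- twice), gives m + 1 distinct vertices of N[v]. Thus m ≤ deg v ≤ Δ(G).
module Submission where

open import Defs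
open import Data.Nat using (ℕ; _≤_)
open import Data.Fin using (Fin)
open import Relation.Binary.PropositionalEquality using (_≡_)
open import Function.Definitions using (Injective)

open import Data.Nat using (zero; suc; _+_; _<_; z≤n; s≤s; s≤s⁻¹; _≤?_)
open import Data.Nat.Properties
  using (≤-trans; ≤-reflexive; n≤1+n; +-suc; +-monoˡ-≤; m≤m⊔n; m≤n⇒m≤o⊔n; ≰⇒>; n<1⇒n≡0)
open import Data.Fin using (zero; suc; _≟_)
open import Data.Fin.Properties using (suc-injective; injective⇒≤; ¬∀⟶∃¬)
open import Data.Bool using (true; false; _∧_)
open import Data.Bool.Properties using (∧-conicalˡ; ∧-conicalʳ; ∧-distribˡ-∨)
open import Data.Product using (∃; ∃₂; _×_; _,_; proj₁; proj₂)
open import Data.Empty using (⊥-elim)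
open import Relation.Nullary using (¬_; Dec; does; yes; no)
open import Relation.Binary.PropositionalEquality using (_≢_; refl; trans; cong; subst)
import Relation.Binary.PropositionalEquality as ≡

infixr 7 _∩ˢ_
infix 4 _⊆_

_∩ˢ_ : ∀ {n} → VSet n → VSet n → VSet n
(A ∩ˢ B) u = A u ∧ B u

_⊆_ : ∀ {n} → VSet n → VSet n → Set
A ⊆ B = ∀ u → A u ≡ true → B u ≡ true

≟-true⇒≡ : ∀ {m} (x y : Fin m) → does (x ≟ y) ≡ true → x ≡ y
≟-true⇒≡ x y e with x ≟ y
... | yes x≡y = x≡y
≟-true⇒≡ x y () | no _

card-mono : ∀ {n} {P Q : VSet n} → P ⊆ Q → card P ≤ card Q
card-mono {zero} P⊆Q = z≤n
card-mono {suc n} {P} {Q} P⊆Q with P zero in p₀ | Q zero in q₀ | card-mono {P = λ i → P (suc i)} (λ u → P⊆Q (suc u))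
... | true  | true  | r = s≤s r
... | true  | false | _ with () ← trans (≡.sym (P⊆Q zero p₀)) q₀
... | false | true  | r = ≤-trans r (n≤1+n _)
... | false | false | r = r

card-∪ : ∀ {n} (A B : VSet n) → card (A ∪ˢ B) ≤ card A + card B
card-∪ {zero} A B = z≤n
card-∪ {suc n} A B with A zero | B zero | card-∪ (λ i → A (suc i)) (λ i → B (suc i))
... | true  | true  | r = s≤s (≤-trans r (≤-trans (n≤1+n _) (≤-reflexive (≡.sym (+-suc _ _)))))
... | true  | false | r = s≤s r
... | false | true  | r = ≤-trans (s≤s r) (≤-reflexive (≡.sym (+-suc _ _)))
... | false | false | r = r

1≤card⇒∃ : ∀ {n} (P : VSet n) → 1 ≤ card P → ∃ λ w → P w ≡ true
1≤card⇒∃ {suc n} P h with P zero in p₀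
... | true = zero , p₀
... | false with 1≤card⇒∃ (λ i → P (suc i)) h
... | w , p = suc w , p

2≤card⇒∃₂ : ∀ {n} (P : VSet n) → 2 ≤ card P → ∃₂ λ a b → a ≢ b × P a ≡ true × P b ≡ true
2≤card⇒∃₂ {suc n} P h with P zero in p₀
... | true with 1≤card⇒∃ (λ i → P (suc i)) (s≤s⁻¹ h)
... | b , p = zero , suc b , (λ ()) , p₀ , p
2≤card⇒∃₂ {suc n} P h | false with 2≤card⇒∃₂ (λ i → P (suc i)) h
... | a , b , a≢b , pa , pb = suc a , suc b , (λ e → a≢b (suc-injective e)) , pa , pb

2≤card⇒∃-other : ∀ {n} (P : VSet n) → 2 ≤ card P → ∀ w → ∃ λ w′ → P w′ ≡ true × w′ ≢ w
2≤card⇒∃-other P h w with 2≤card⇒∃₂ P h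
... | a , b , a≢b , pa , pb with a ≟ w
...   | yes refl = b , pb , λ b≡a → a≢b (≡.sym b≡a)
...   | no a≢w = a , pa , a≢w

-- The position of w among the elements of P, an injection of P into Fin (card P).
rank : ∀ {n} (P : VSet n) w → P w ≡ true → Fin (card P)
rank {suc n} P zero p with P zero
rank P zero p  | true  = zero
rank P zero () | false
rank {suc n} P (suc w) p with P zero
... | true  = suc (rank (λ i → P (suc i)) w p)
... | false = rank (λ i → P (suc i)) w p

rank-injective : ∀ {n} (P : VSet n) w w′ (p : P w ≡ true) (p′ : P w′ ≡ true) →
                 rank P w p ≡ rank P w′ p′ → w ≡ w′
rank-injective {suc n} P zero zero p p′ e = refl
rank-injective {suc n} P zero (suc w′) p p′ e with P zero
rank-injective P zero (suc w′) p  p′ () | true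
rank-injective P zero (suc w′) () p′ e  | false
rank-injective {suc n} P (suc w) zero p p′ e with P zero
rank-injective P (suc w) zero p p′ () | true
rank-injective P (suc w) zero p () e  | false
rank-injective {suc n} P (suc w) (suc w′) p p′ e with P zero
... | true  = cong suc (rank-injective (λ i → P (suc i)) w w′ p p′ (suc-injective e))
... | false = cong suc (rank-injective (λ i → P (suc i)) w w′ p p′ e)

injective⇒≤card : ∀ {n k} (P : VSet n) (h : Fin k → Fin n) → Injective _≡_ _≡_ h →
                  (∀ t → P (h t) ≡ true) → k ≤ card P
injective⇒≤card P h h-inj h∈P = injective⇒≤ {f = λ t → rank P (h t) (h∈P t)}
  (λ {x} {y} e → h-inj (rank-injective P (h x) (h y) (h∈P x) (h∈P y) e))

fresh⇒<card : ∀ {n m} (P : VSet n) (h : Fin m → Fin n) → Injective _≡_ _≡_ h →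
              (∀ t → P (h t) ≡ true) → ∀ u → P u ≡ true → (∀ t → u ≢ h t) → m < card P
fresh⇒<card {n} {m} P h h-inj h∈P u u∈P u-fresh = injective⇒≤card P g g-inj g∈P
  where
  g : Fin (suc m) → Fin n
  g zero    = u
  g (suc t) = h t

  g∈P : ∀ t → P (g t) ≡ true
  g∈P zero    = u∈P
  g∈P (suc t) = h∈P t

  g-inj : Injective _≡_ _≡_ g
  g-inj {zero}  {zero}  _ = refl
  g-inj {zero}  {suc t} e = ⊥-elim (u-fresh t e)
  g-inj {suc t} {zero}  e = ⊥-elim (u-fresh t (≡.sym e))
  g-inj {suc t} {suc s} e = cong suc (h-inj e)

card-singleton≤1 : ∀ {n} (v : Fin n) → card (λ u → does (u ≟ v)) ≤ 1
card-singleton≤1 v with 2 ≤? card (λ u → does (u ≟ v))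
... | no ≱2 = s≤s⁻¹ (≰⇒> ≱2)
... | yes ≥2 with 2≤card⇒∃₂ (λ u → does (u ≟ v)) ≥2
...   | a , b , a≢b , a≡v , b≡v = ⊥-elim (a≢b (trans (≟-true⇒≡ a v a≡v) (≡.sym (≟-true⇒≡ b v b≡v))))

maxOver-upper : ∀ {n} (f : Fin n → ℕ) v → f v ≤ maxOver f
maxOver-upper f zero    = m≤m⊔n _ _
maxOver-upper f (suc v) = m≤n⇒m≤o⊔n (f zero) (maxOver-upper (λ i → f (suc i)) v)

module _ (G : Graph) where

  closedNbr-self : ∀ v → closedNbr G v v ≡ true
  closedNbr-self v with v ≟ v
  ... | yes _   = refl
  ... | no v≢v = ⊥-elim (v≢v refl)

  card-closedNbr≤ : ∀ v → card (closedNbr G v) ≤ suc (degree G v)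
  card-closedNbr≤ v = ≤-trans (card-∪ (λ u → does (u ≟ v)) (adj G v))
                              (+-monoˡ-≤ (degree G v) (card-singleton≤1 v))

  ¬doubleDominating⇒∃ : ∀ {D} → ¬ DoubleDominating G D →
                        ∃ λ v → card (closedNbr G v ∩ˢ D) ≤ 1
  ¬doubleDominating⇒∃ {D} ¬dd with ¬∀⟶∃¬ (n G) _ (λ v → 2 ≤? card (closedNbr G v ∩ˢ D)) ¬dd
  ... | v , ≱2 = v , s≤s⁻¹ (≰⇒> ≱2)

  doubleDominating-∪ : ∀ {X Y} → DoubleDominating G (X ∪ˢ Y) →
                       ∀ v → 2 ≤ card (closedNbr G v ∩ˢ X) + card (closedNbr G v ∩ˢ Y)
  doubleDominating-∪ {X} {Y} dd v =
    ≤-trans (dd v) (≤-trans (card-mono distrib) (card-∪ (closedNbr G v ∩ˢ X) (closedNbr G v ∩ˢ Y)))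
    where
    distrib : closedNbr G v ∩ˢ (X ∪ˢ Y) ⊆ (closedNbr G v ∩ˢ X) ∪ˢ (closedNbr G v ∩ˢ Y)
    distrib u e = trans (≡.sym (∧-distribˡ-∨ (closedNbr G v u) (X u) (Y u))) e

  module _ {k} (c : Fin (n G) → Fin k) where

    representatives : ∀ {m} (S : VSet (n G)) (f : Fin m → Fin k) → Injective _≡_ _≡_ f →
      (∀ t → 1 ≤ card (S ∩ˢ part G c (f t))) →
      ∃ λ (w : Fin m → Fin (n G)) → Injective _≡_ _≡_ w × (∀ t → S (w t) ≡ true) × (∀ t → c (w t) ≡ f t)
    representatives {m} S f f-inj meets = w , w-inj , (λ t → ∧-conicalˡ _ _ (w∈ t)) , class
      where
      chosen : ∀ t → ∃ λ u → (S ∩ˢ part G c (f t)) u ≡ true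
      chosen t = 1≤card⇒∃ (S ∩ˢ part G c (f t)) (meets t)

      w : Fin m → Fin (n G)
      w t = proj₁ (chosen t)

      w∈ : ∀ t → (S ∩ˢ part G c (f t)) (w t) ≡ true
      w∈ t = proj₂ (chosen t)

      class : ∀ t → c (w t) ≡ f t
      class t = ≟-true⇒≡ (c (w t)) (f t) (∧-conicalʳ _ _ (w∈ t))

      w-inj : Injective _≡_ _≡_ w
      w-inj {t} {s} e = f-inj (trans (≡.sym (class t)) (trans (cong c e) (class s)))

    classesMeeting<card : ∀ {m} (S : VSet (n G)) (f : Fin m → Fin k) → Injective _≡_ _≡_ f →
      (∀ t → 1 ≤ card (S ∩ˢ part G c (f t))) →
      ∀ i → (∀ t → i ≢ f t) → 1 ≤ card (S ∩ˢ part G c i) → m < card S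
    classesMeeting<card S f f-inj meets i i-fresh meets-i
      with u , u∈ ← 1≤card⇒∃ (S ∩ˢ part G c i) meets-i
         | w , w-inj , w∈S , class ← representatives S f f-inj meets =
      fresh⇒<card S w w-inj w∈S u (∧-conicalˡ _ _ u∈) u-fresh
      where
      u-fresh : ∀ t → u ≢ w t
      u-fresh t u≡w = i-fresh t (trans (≡.sym (≟-true⇒≡ (c u) i (∧-conicalʳ _ _ u∈)))
                                       (trans (cong c u≡w) (class t)))

    -- The second vertex of S in the class f zero is the extra one.
    classesMeetingTwice<card : ∀ {m} (S : VSet (n G)) (f : Fin m → Fin k) → Injective _≡_ _≡_ f →
      (∀ t → 2 ≤ card (S ∩ˢ part G c (f t))) → 0 < card S → m < card S
    classesMeetingTwice<card {zero} S f f-inj twice S≢∅ = S≢∅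
    classesMeetingTwice<card {suc m} S f f-inj twice _
      with w , w-inj , w∈S , class ← representatives S f f-inj (λ t → ≤-trans (n≤1+n 1) (twice t))
      with u , u∈ , u≢w₀ ← 2≤card⇒∃-other (S ∩ˢ part G c (f zero)) (twice zero) (w zero) =
      fresh⇒<card S w w-inj w∈S u (∧-conicalˡ _ _ u∈) u-fresh
      where
      u-fresh : ∀ t → u ≢ w t
      u-fresh t u≡w with f-inj (trans (≡.sym (≟-true⇒≡ (c u) (f zero) (∧-conicalʳ _ _ u∈)))
                                      (trans (cong c u≡w) (class t)))
      ... | refl = u≢w₀ u≡w

    coalitionPartners<card : ∀ i {m} (f : Fin m → Fin k) → Injective _≡_ _≡_ f →
      (∀ t → DoubleCoalition G (part G c i) (part G c (f t))) →
      ∀ v → card (closedNbr G v ∩ˢ part G c i) ≤ 1 → m < card (closedNbr G v)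
    coalitionPartners<card i {m} f f-inj coal v few = byMeetingX (1 ≤? card (S ∩ˢ X))
      where
      S = closedNbr G v
      X = part G c i

      twice : ∀ t → 2 ≤ card (S ∩ˢ X) + card (S ∩ˢ part G c (f t))
      twice t with _ , _ , _ , dd ← coal t = doubleDominating-∪ dd v

      byMeetingX : Dec (1 ≤ card (S ∩ˢ X)) → m < card S
      byMeetingX (yes meets-X) = classesMeeting<card S f f-inj meets i i-fresh meets-X
        where
        meets : ∀ t → 1 ≤ card (S ∩ˢ part G c (f t))
        meets t = s≤s⁻¹ (≤-trans (twice t) (+-monoˡ-≤ _ few))
        i-fresh : ∀ t → i ≢ f t
        i-fresh t refl with disjoint , _ ← coal t | u , u∈ ← 1≤card⇒∃ (S ∩ˢ X) meets-X
          with () ← trans (≡.sym (cong (λ b → b ∧ b) (∧-conicalʳ (S u) (X u) u∈))) (disjoint u)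
      byMeetingX (no misses-X) = classesMeetingTwice<card S f f-inj twice′ S≢∅
        where
        twice′ : ∀ t → 2 ≤ card (S ∩ˢ part G c (f t))
        twice′ t = subst (λ a → 2 ≤ a + card (S ∩ˢ part G c (f t))) (n<1⇒n≡0 (≰⇒> misses-X)) (twice t)
        S≢∅ : 0 < card S
        S≢∅ = fresh⇒<card S (λ ()) (λ {}) (λ ()) v (closedNbr-self v) (λ ())

mainTheorem4 : (G : Graph) → NoIsolatedVertex G →
    (k : ℕ) (c : Fin (n G) → Fin k) → IsDCMaxPartition G k c →
    (i : Fin k) (m : ℕ) (f : Fin m → Fin k) → Injective _≡_ _≡_ f →
    (∀ t → DoubleCoalition G (part G c i) (part G c (f t))) →
    m ≤ maxDegree G
mainTheorem4 G _ k c ((_ , notDD , _) , _) i m f f-inj coal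
  with v , few ← ¬doubleDominating⇒∃ G (notDD i) =
  ≤-trans (s≤s⁻¹ (≤-trans (coalitionPartners<card G c i f f-inj coal v few) (card-closedNbr≤ G v)))
          (maxOver-upper (degree G) v)
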